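{- Let $n\geq r\geq 3$ and let $\mathcal{H}$ be a $2$-connected $r$-graph on $n$ vertices. Then for any two distinct vertices $u,v\in V(\mathcal{H})$, there exist two disjoint Berge paths between $u$ and $v$, i.e., two Berge paths from $u$ to $v$ that share no defining vertices other than $u$ and $v$ and share no defining hyperedges.
   Context: An $r$-graph is a hypergraph all of whose hyperedges are $r$-sets. A Berge path from $u$ to $v$ consists of distinct (defining) vertices $u=v_1,v_2,\dots,v_m=v$ and distinct (defining) hyperedges $e_1,\dots,e_{m-1}$ with $\{v_i,v_{i+1}\}\subseteq e_i$. A hypergraph is connected if its vertex set cannot be partitioned into two nonempty parts with no hyperedge meeting both. $\mathcal{H}$ is $2$-connected if it is connected and has neither a cut vertex (a vertex $w$ with $V(\mathcal{H})=\{w\}\cup V_1\cup V_2$, $V_1,V_2$ nonempty and disjoint, every hyperedge contained in $\{w\}\cup V_1$ or $\{w\}\cup V_2$) nor a cut hyperedge (a hyperedge $e$ with $V(\mathcal{H})=V_1\cup V_2$, $V_1,V_2$ nonempty and disjoint, every hyperedge $f\ne e$ contained in $V_1$ or in $V_2$). -}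

module Defs where

open import Data.Nat using (ℕ; suc)
open import Data.Fin using (Fin; zero; suc; fromℕ; inject₁)
open import Data.Fin.Subset using (Subset; _∈_; _∉_; _⊆_; _∪_; ⁅_⁆; ∣_∣; Nonempty)
open import Data.Product using (Σ; ∃; _×_)
open import Data.Sum using (_⊎_)
open import Relation.Nullary using (¬_)
open import Relation.Binary.PropositionalEquality using (_≡_; _≢_)
open import Function.Definitions using (Injective)

-- A hypergraph on vertex set Fin n with m hyperedges, given as an
-- indexing  E : Fin m → Subset n  (injective = no repeated hyperedges).

IsRGraph : ∀ {n m} → ℕ → (Fin m → Subset n) → Set
IsRGraph r E = Injective _≡_ _≡_ E × (∀ e → ∣ E e ∣ ≡ r)

Meets : ∀ {n} → Subset n → Subset n → Set
Meets e A = ∃ λ x → x ∈ e × x ∈ A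

DisjointSets : ∀ {n} → Subset n → Subset n → Set
DisjointSets V₁ V₂ = ∀ x → x ∈ V₁ → x ∉ V₂

Connected : ∀ {n m} → (Fin m → Subset n) → Set
Connected {n} E =
  ¬ (Σ (Subset n) λ V₁ → Σ (Subset n) λ V₂ →
       Nonempty V₁ × Nonempty V₂ × DisjointSets V₁ V₂ ×
       (∀ x → x ∈ V₁ ⊎ x ∈ V₂) ×
       (∀ e → ¬ (Meets (E e) V₁ × Meets (E e) V₂)))

IsCutVertex : ∀ {n m} → (Fin m → Subset n) → Fin n → Set
IsCutVertex {n} E w =
  Σ (Subset n) λ V₁ → Σ (Subset n) λ V₂ →
    Nonempty V₁ × Nonempty V₂ × DisjointSets V₁ V₂ × w ∉ V₁ × w ∉ V₂ ×
    (∀ x → x ≡ w ⊎ x ∈ V₁ ⊎ x ∈ V₂) ×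
    (∀ e → E e ⊆ (⁅ w ⁆ ∪ V₁) ⊎ E e ⊆ (⁅ w ⁆ ∪ V₂))

IsCutEdge : ∀ {n m} → (Fin m → Subset n) → Fin m → Set
IsCutEdge {n} E e =
  Σ (Subset n) λ V₁ → Σ (Subset n) λ V₂ →
    Nonempty V₁ × Nonempty V₂ × DisjointSets V₁ V₂ ×
    (∀ x → x ∈ V₁ ⊎ x ∈ V₂) ×
    (∀ f → f ≢ e → E f ⊆ V₁ ⊎ E f ⊆ V₂)

TwoConnected : ∀ {n m} → (Fin m → Subset n) → Set
TwoConnected E = Connected E × (∀ w → ¬ IsCutVertex E w) × (∀ e → ¬ IsCutEdge E e)

record BergePath {n m} (E : Fin m → Subset n) (u v : Fin n) : Set where
  field
    len      : ℕ
    vert     : Fin (suc len) → Fin n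
    edge     : Fin len → Fin m
    vert-inj : Injective _≡_ _≡_ vert
    edge-inj : Injective _≡_ _≡_ edge
    start    : vert zero ≡ u
    end      : vert (fromℕ len) ≡ v
    link     : ∀ i → vert (inject₁ i) ∈ E (edge i) × vert (suc i) ∈ E (edge i)

open BergePath public

DisjointPaths : ∀ {n m} {E : Fin m → Subset n} {u v : Fin n} →
                BergePath E u v → BergePath E u v → Set
DisjointPaths {u = u} {v} P Q =
  (∀ i j → vert P i ≡ vert Q j → vert P i ≡ u ⊎ vert P i ≡ v) ×
  (∀ i j → edge P i ≢ edge Q j)

{-# OPTIONS --safe #-}
-- Work in the bipartite incidence graph, whose nodes are the vertices and the hyperedges.
-- Having no cut vertex and no cut hyperedge means that from u every node can be reached
-- avoiding any other given node (this needs hyperedges of size at least 2, which is all that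
-- r ≥ 3 is used for). Whitney's argument then carries a pair of internally disjoint walks
-- from u along any u–v walk one edge at a time. Shortcutting both walks to paths, their
-- alternating vertex/hyperedge sequences are disjoint Berge paths.
module Submission where

open import Defs
open import Level using (0ℓ)
open import Data.Nat using (ℕ; zero; suc; _+_; _≤_; _<_; s≤s)
open import Data.Nat.Properties
  using (<⇒≱; n<1+n; m≤m+n; n≤1+n; +-suc; +-monoʳ-≤; ≤-reflexive; ≤-trans)
open import Data.Fin using (Fin; fromℕ; inject₁) renaming (zero to fzero; suc to fsuc)
open import Data.Fin.Properties using (any?) renaming (_≟_ to _≟ᶠ_)
open import Data.Fin.Subset using (Subset; _∈_; _∉_; _⊆_; _∪_; _∩_; ∁; ⁅_⁆; ∣_∣)
open import Data.Fin.Subset.Properties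
  using (_∈?_; ∣p∣≤n; p⊂q⇒∣p∣<∣q∣; p⊆q⇒∣p∣≤∣q∣; ∣⁅x⁆∣≡1; x∈⁅x⁆; x∈⁅y⁆⇒x≡y; x∈p∪q⁻; x∈p∪q⁺; p⊆p∪q;
         x∈p∩q⁺; x∈p∩q⁻; x∈p⇒x∉∁p; x∈∁p⇒x∉p; x∉p⇒x∈∁p)
open import Data.Product as Product using (Σ; ∃; _×_; _,_; proj₁; proj₂)
open import Data.Sum as Sum using (_⊎_; inj₁; inj₂; fromInj₁)
open import Data.Sum.Properties using (≡-dec; inj₁-injective; inj₂-injective)
open import Data.Empty using (⊥; ⊥-elim)
open import Data.Unit using (⊤; tt)
open import Function using (id; _∘_)
open import Function.Definitions using (Injective)
open import Relation.Nullary using (¬_; Dec; yes; no; ¬?; _×-dec_; _⊎-dec_)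
open import Relation.Nullary.Decidable using (decidable-stable)
open import Relation.Unary using (Pred; Decidable)
open import Relation.Binary using (Rel; Symmetric; DecidableEquality)
open import Relation.Binary.PropositionalEquality using (_≡_; _≢_; refl; sym; subst; cong)

module Walks {N : Set} (_≟_ : DecidableEquality N) (Adj : Rel N 0ℓ) (Adj-sym : Symmetric Adj) where

  data Walk : N → N → Set where
    nil  : (x : N) → Walk x x
    cons : (x : N) {y z : N} → Adj x y → Walk y z → Walk x z

  infix 4 _∈ʷ_ _∉ʷ_ _∈ʷ⁻_ _⊆ʷ_ _⊆ʷ⁻_

  _∈ʷ_ : ∀ {x y} → N → Walk x y → Set
  k ∈ʷ nil x      = k ≡ x
  k ∈ʷ cons x _ p = k ≡ x ⊎ k ∈ʷ p

  _∉ʷ_ : ∀ {x y} → N → Walk x y → Set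
  k ∉ʷ p = ¬ k ∈ʷ p

  _∈ʷ⁻_ : ∀ {x y} → N → Walk x y → Set
  k ∈ʷ⁻ nil x      = ⊥
  k ∈ʷ⁻ cons x _ p = k ≡ x ⊎ k ∈ʷ⁻ p

  _⊆ʷ_ : ∀ {x y x′ y′} → Walk x y → Walk x′ y′ → Set
  p ⊆ʷ q = ∀ {k} → k ∈ʷ p → k ∈ʷ q

  _⊆ʷ⁻_ : ∀ {x y x′ y′} → Walk x y → Walk x′ y′ → Set
  p ⊆ʷ⁻ q = ∀ {k} → k ∈ʷ⁻ p → k ∈ʷ⁻ q

  _∈ʷ?_ : ∀ {x y} (k : N) (p : Walk x y) → Dec (k ∈ʷ p)
  k ∈ʷ? nil x      = k ≟ x
  k ∈ʷ? cons x _ p = k ≟ x ⊎-dec k ∈ʷ? p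

  start∈ʷ : ∀ {x y} (p : Walk x y) → x ∈ʷ p
  start∈ʷ (nil x)      = refl
  start∈ʷ (cons x _ p) = inj₁ refl

  end∈ʷ : ∀ {x y} (p : Walk x y) → y ∈ʷ p
  end∈ʷ (nil x)      = refl
  end∈ʷ (cons x _ p) = inj₂ (end∈ʷ p)

  ∈ʷ⇒∈ʷ⁻⊎≡end : ∀ {x y k} (p : Walk x y) → k ∈ʷ p → k ∈ʷ⁻ p ⊎ k ≡ y
  ∈ʷ⇒∈ʷ⁻⊎≡end (nil x)      k≡x        = inj₂ k≡x
  ∈ʷ⇒∈ʷ⁻⊎≡end (cons x _ p) (inj₁ k≡x) = inj₁ (inj₁ k≡x)
  ∈ʷ⇒∈ʷ⁻⊎≡end (cons x _ p) (inj₂ k∈p) = Sum.map₁ inj₂ (∈ʷ⇒∈ʷ⁻⊎≡end p k∈p)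

  _++_ : ∀ {x y z} → Walk x y → Walk y z → Walk x z
  nil x      ++ q = q
  cons x a p ++ q = cons x a (p ++ q)

  ∈ʷ-++⁻ : ∀ {x y z k} (p : Walk x y) {q : Walk y z} → k ∈ʷ p ++ q → k ∈ʷ p ⊎ k ∈ʷ q
  ∈ʷ-++⁻ (nil x)      k∈q          = inj₂ k∈q
  ∈ʷ-++⁻ (cons x _ p) (inj₁ k≡x)   = inj₁ (inj₁ k≡x)
  ∈ʷ-++⁻ (cons x _ p) (inj₂ k∈p++q) = Sum.map₁ inj₂ (∈ʷ-++⁻ p k∈p++q)

  reverse : ∀ {x y} → Walk x y → Walk y x
  reverse (nil x)          = nil x
  reverse (cons x {y} a p) = reverse p ++ cons y (Adj-sym a) (nil x)

  ∈ʷ-reverse⁻ : ∀ {x y k} (p : Walk x y) → k ∈ʷ reverse p → k ∈ʷ p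
  ∈ʷ-reverse⁻ (nil x)      k∈ = k∈
  ∈ʷ-reverse⁻ (cons x a p) k∈ with ∈ʷ-++⁻ (reverse p) k∈
  ... | inj₁ k∈rev        = inj₂ (∈ʷ-reverse⁻ p k∈rev)
  ... | inj₂ (inj₁ refl)  = inj₂ (start∈ʷ p)
  ... | inj₂ (inj₂ k≡x)   = inj₁ k≡x

  WalkWithin : Pred N 0ℓ → N → N → Set
  WalkWithin A x y = Σ (Walk x y) λ p → ∀ {k} → k ∈ʷ p → A k

  WalkAvoiding : N → N → N → Set
  WalkAvoiding w = WalkWithin (_≢ w)

  _++ᵂ_ : ∀ {A x y z} → WalkWithin A x y → WalkWithin A y z → WalkWithin A x z
  (p , p-within) ++ᵂ (q , q-within) = p ++ q , Sum.[ p-within , q-within ] ∘ ∈ʷ-++⁻ p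

  record PrefixUntil {x y} (D : Pred N 0ℓ) (p : Walk x y) (z : N) : Set where
    field
      walk     : Walk x z
      ⊆-whole  : walk ⊆ʷ p
      ⊆⁻-whole : walk ⊆ʷ⁻ p
      misses   : ∀ {k} → k ∈ʷ⁻ walk → ¬ D k

  open PrefixUntil public

  firstHit : ∀ {D x y k} → Decidable D → (p : Walk x y) → k ∈ʷ p → D k →
             ∃ λ z → D z × PrefixUntil D p z
  firstHit D? (nil x) refl Dx =
    x , Dx , record { walk = nil x ; ⊆-whole = id ; ⊆⁻-whole = id ; misses = λ () }
  firstHit D? (cons x a p) k∈ Dk with D? x
  ... | yes Dx = x , Dx , record { walk = nil x ; ⊆-whole = inj₁ ; ⊆⁻-whole = λ () ; misses = λ () }
  ... | no ¬Dx with k∈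
  ...   | inj₁ refl = ⊥-elim (¬Dx Dk)
  ...   | inj₂ k∈p with firstHit D? p k∈p Dk
  ...     | z , Dz , q = z , Dz , record
    { walk     = cons x a (walk q)
    ; ⊆-whole  = Sum.map₂ (⊆-whole q)
    ; ⊆⁻-whole = Sum.map₂ (⊆⁻-whole q)
    ; misses   = λ { (inj₁ refl) → ¬Dx ; (inj₂ k∈q) → misses q k∈q } }

  prefixTo : ∀ {x y z} (p : Walk x y) → z ∈ʷ p → PrefixUntil (_≡ z) p z
  prefixTo {z = z} p z∈p with firstHit (_≟ z) p z∈p refl
  ... | _ , refl , q = q

  record DisjointWalks (s t : N) : Set where
    field
      left right : Walk s t
      disjoint   : ∀ {k} → k ∈ʷ left → k ∈ʷ right → k ≡ s ⊎ k ≡ t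

  open DisjointWalks public

  OnEither : ∀ {s t} → DisjointWalks s t → Pred N 0ℓ
  OnEither T k = k ∈ʷ left T ⊎ k ∈ʷ right T

  onEither? : ∀ {s t} (T : DisjointWalks s t) → Decidable (OnEither T)
  onEither? T k = k ∈ʷ? left T ⊎-dec k ∈ʷ? right T

  swap : ∀ {s t} → DisjointWalks s t → DisjointWalks s t
  swap T = record { left = right T ; right = left T ; disjoint = λ k∈r k∈l → disjoint T k∈l k∈r }

  stay : ∀ s → DisjointWalks s s
  stay s = record { left = nil s ; right = nil s ; disjoint = λ k≡s _ → inj₁ k≡s }

  edgeTwice : ∀ {s t} → Adj s t → DisjointWalks s t
  edgeTwice {s} {t} a =
    record { left = cons s a (nil t) ; right = cons s a (nil t) ; disjoint = λ k∈ _ → k∈ }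

  VisitsEndOnce : ∀ {x y} → Walk x y → Set
  VisitsEndOnce {y = y} p = ∀ {k} → k ∈ʷ⁻ p → k ≢ y

  trim : ∀ {s t} → DisjointWalks s t →
         Σ (DisjointWalks s t) λ T → VisitsEndOnce (left T) × VisitsEndOnce (right T)
  trim {t = t} T = record
    { left     = walk P
    ; right    = walk Q
    ; disjoint = λ k∈P k∈Q → disjoint T (⊆-whole P k∈P) (⊆-whole Q k∈Q)
    } , misses P , misses Q
    where
      P : PrefixUntil (_≡ t) (left T) t
      P = prefixTo (left T) (end∈ʷ (left T))

      Q : PrefixUntil (_≡ t) (right T) t
      Q = prefixTo (right T) (end∈ʷ (right T))

  reroute : ∀ {s w v z} (T : DisjointWalks s w) → VisitsEndOnce (left T) → Adj w v →
            z ∈ʷ left T → z ≢ w → (R : Walk z v) → (∀ {k} → k ∈ʷ R → k ≡ z ⊎ ¬ OnEither T k) →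
            DisjointWalks s v
  reroute {s} {w} {v} {z} T left-once w~v z∈P z≢w R R-fresh = record
    { left = walk P-to-z ++ R ; right = Q ++ cons w w~v (nil v) ; disjoint = disjoint′ }
    where
      P Q : Walk s w
      P = left T
      Q = right T

      P-to-z : PrefixUntil (_≡ z) P z
      P-to-z = prefixTo P z∈P

      P-to-z-avoids-w : ∀ {k} → k ∈ʷ walk P-to-z → k ≢ w
      P-to-z-avoids-w k∈ with ∈ʷ⇒∈ʷ⁻⊎≡end (walk P-to-z) k∈
      ... | inj₁ k∈⁻  = left-once (⊆⁻-whole P-to-z k∈⁻)
      ... | inj₂ refl = z≢w

      w∉new : w ∉ʷ walk P-to-z ++ R
      w∉new w∈ with ∈ʷ-++⁻ (walk P-to-z) w∈
      ... | inj₁ w∈P-to-z = P-to-z-avoids-w w∈P-to-z refl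
      ... | inj₂ w∈R with R-fresh w∈R
      ...   | inj₁ w≡z  = z≢w (sym w≡z)
      ...   | inj₂ fresh = fresh (inj₁ (end∈ʷ P))

      new∩Q : ∀ {k} → k ∈ʷ walk P-to-z ++ R → k ∈ʷ Q → k ≡ s
      new∩Q k∈new k∈Q with ∈ʷ-++⁻ (walk P-to-z) k∈new
      ... | inj₁ k∈P-to-z =
        fromInj₁ (⊥-elim ∘ P-to-z-avoids-w k∈P-to-z) (disjoint T (⊆-whole P-to-z k∈P-to-z) k∈Q)
      ... | inj₂ k∈R with R-fresh k∈R
      ...   | inj₁ refl  = fromInj₁ (⊥-elim ∘ z≢w) (disjoint T z∈P k∈Q)
      ...   | inj₂ fresh = ⊥-elim (fresh (inj₂ k∈Q))

      disjoint′ : ∀ {k} → k ∈ʷ walk P-to-z ++ R → k ∈ʷ Q ++ cons w w~v (nil v) → k ≡ s ⊎ k ≡ v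
      disjoint′ k∈new k∈Q+ with ∈ʷ-++⁻ Q k∈Q+
      ... | inj₁ k∈Q          = inj₁ (new∩Q k∈new k∈Q)
      ... | inj₂ (inj₁ refl)  = ⊥-elim (w∉new k∈new)
      ... | inj₂ (inj₂ k≡v)   = inj₂ k≡v

  module Whitney (s : N) (avoid : ∀ {w y} → s ≢ w → y ≢ w → WalkAvoiding w s y) where

    -- R starts on both walks (at s); its stretch after its last visit to them is spliced
    -- onto the walk it leaves from, while the other walk continues through w to v.
    extendNondegenerate : ∀ {w v} → w ≢ s → v ≢ w → Adj w v →
                          DisjointWalks s w → DisjointWalks s v
    extendNondegenerate {w} {v} w≢s v≢w w~v T with trim T | avoid (w≢s ∘ sym) v≢w
    ... | T′ , left-once , right-once | R , R-avoids-w
      with firstHit (onEither? T′) (reverse R) (end∈ʷ (reverse R)) (inj₁ (start∈ʷ (left T′)))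
    ...   | z , hits , R-to-z = reconnect hits
      where
        back : Walk z v
        back = reverse (walk R-to-z)

        z≢w : z ≢ w
        z≢w = R-avoids-w (∈ʷ-reverse⁻ R (⊆-whole R-to-z (end∈ʷ (walk R-to-z))))

        back-fresh : ∀ {k} → k ∈ʷ back → k ≡ z ⊎ ¬ OnEither T′ k
        back-fresh k∈ = Sum.swap (Sum.map₁ (misses R-to-z)
          (∈ʷ⇒∈ʷ⁻⊎≡end (walk R-to-z) (∈ʷ-reverse⁻ (walk R-to-z) k∈)))

        reconnect : OnEither T′ z → DisjointWalks s v
        reconnect (inj₁ z∈left)  = reroute T′ left-once w~v z∈left z≢w back back-fresh
        reconnect (inj₂ z∈right) = swap (reroute (swap T′) right-once w~v z∈right z≢w back
                                           (Sum.map₂ (_∘ Sum.swap) ∘ back-fresh))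

    extend : ∀ {w v} → Adj w v → DisjointWalks s w → DisjointWalks s v
    extend {w} {v} w~v T with w ≟ s | v ≟ w
    ... | yes refl | _        = edgeTwice w~v
    ... | no _     | yes refl = T
    ... | no w≢s   | no v≢w   = extendNondegenerate w≢s v≢w w~v T

    extendAlong : ∀ {x t} → DisjointWalks s x → Walk x t → DisjointWalks s t
    extendAlong T (nil _)      = T
    extendAlong T (cons _ a p) = extendAlong (extend a T) p

    disjointWalks : ∀ {t} → Walk s t → DisjointWalks s t
    disjointWalks = extendAlong (stay s)

  IsPath : ∀ {x y} → Walk x y → Set
  IsPath (nil x)      = ⊤
  IsPath (cons x _ p) = x ∉ʷ p × IsPath p

  suffixFrom : ∀ {x y z} (p : Walk y z) → x ∈ʷ p →
               Σ (Walk x z) λ q → q ⊆ʷ p × (IsPath p → IsPath q)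
  suffixFrom (nil y)      refl        = nil y , id , id
  suffixFrom (cons y a p) (inj₁ refl) = cons y a p , id , id
  suffixFrom (cons y a p) (inj₂ x∈p) with suffixFrom p x∈p
  ... | q , q⊆p , q-path = q , inj₂ ∘ q⊆p , q-path ∘ proj₂

  toPath : ∀ {x y} (p : Walk x y) → Σ (Walk x y) λ q → IsPath q × q ⊆ʷ p
  toPath (nil x) = nil x , tt , id
  toPath (cons x a p) with toPath p
  ... | q , q-path , q⊆p with x ∈ʷ? q
  ...   | no x∉q  = cons x a q , (x∉q , q-path) , Sum.map₂ q⊆p
  ...   | yes x∈q with suffixFrom q x∈q
  ...     | q′ , q′⊆q , q′-path = q′ , q′-path q-path , inj₂ ∘ q⊆p ∘ q′⊆q

∃∈-≢ : ∀ {n} (p : Subset n) x₀ → 2 ≤ ∣ p ∣ → ∃ λ x → x ∈ p × x ≢ x₀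
∃∈-≢ p x₀ 2≤∣p∣ with any? (λ x → (x ∈? p) ×-dec ¬? (x ≟ᶠ x₀))
... | yes found = found
... | no none =
  ⊥-elim (2≰1 (≤-trans 2≤∣p∣ (≤-trans (p⊆q⇒∣p∣≤∣q∣ p⊆⁅x₀⁆) (≤-reflexive (∣⁅x⁆∣≡1 x₀)))))
  where
    p⊆⁅x₀⁆ : p ⊆ ⁅ x₀ ⁆
    p⊆⁅x₀⁆ {x} x∈p with x ≟ᶠ x₀
    ... | yes refl = x∈⁅x⁆ x
    ... | no x≢x₀  = ⊥-elim (none (x , x∈p , x≢x₀))

    2≰1 : ¬ (2 ≤ 1)
    2≰1 (s≤s ())

∈⊎∈∁ : ∀ {n} (S : Subset n) x → x ∈ S ⊎ x ∈ ∁ S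
∈⊎∈∁ S x with x ∈? S
... | yes x∈S = inj₁ x∈S
... | no x∉S  = inj₂ (x∉p⇒x∈∁p x∉S)

module Incidence {n m : ℕ} (E : Fin m → Subset n) where

  Node : Set
  Node = Fin n ⊎ Fin m

  Incident : Rel Node 0ℓ
  Incident (inj₁ x) (inj₂ e) = x ∈ E e
  Incident (inj₂ e) (inj₁ x) = x ∈ E e
  Incident _        _        = ⊥

  Incident-sym : Symmetric Incident
  Incident-sym {inj₁ _} {inj₂ _} x∈e = x∈e
  Incident-sym {inj₂ _} {inj₁ _} x∈e = x∈e

  _≟ᴺ_ : DecidableEquality Node
  _≟ᴺ_ = ≡-dec _≟ᶠ_ _≟ᶠ_

  open Walks _≟ᴺ_ Incident Incident-sym public

  module Closure (A : Pred Node 0ℓ) (A? : Decidable A) where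

    Reached : Fin n → Subset n → Set
    Reached s S = ∀ {x} → x ∈ S → WalkWithin A (inj₁ s) (inj₁ x)

    Step : Subset n → Fin n → Set
    Step S y = A (inj₁ y) × ∃ λ e → A (inj₂ e) × y ∈ E e × ∃ λ x → x ∈ S × x ∈ E e

    step? : ∀ S → Decidable (Step S)
    step? S y = A? (inj₁ y) ×-dec any? λ e → A? (inj₂ e) ×-dec (y ∈? E e) ×-dec
                  any? (λ x → (x ∈? S) ×-dec (x ∈? E e))

    Closed : Subset n → Set
    Closed S = ∀ {y} → Step S y → y ∈ S

    reached-step : ∀ {s S y} → Reached s S → Step S y → Reached s (S ∪ ⁅ y ⁆)
    reached-step {S = S} {y} reached (Ay , e , Ae , y∈e , x , x∈S , x∈e) z∈
      with x∈p∪q⁻ S ⁅ y ⁆ z∈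
    ... | inj₁ z∈S = reached z∈S
    ... | inj₂ z∈⁅y⁆ rewrite x∈⁅y⁆⇒x≡y y z∈⁅y⁆ = reached x∈S ++ᵂ hop
      where
        hop : WalkWithin A (inj₁ x) (inj₁ y)
        hop = cons _ x∈e (cons _ y∈e (nil _))
            , λ { (inj₁ refl)        → proj₂ (reached x∈S) (end∈ʷ (proj₁ (reached x∈S)))
                ; (inj₂ (inj₁ refl)) → Ae
                ; (inj₂ (inj₂ refl)) → Ay }

    -- every round adds a vertex to S, so the fuel cannot run out
    grow : ∀ {s} fuel S → Reached s S → n < fuel + ∣ S ∣ →
           Σ (Subset n) λ S′ → S ⊆ S′ × Reached s S′ × Closed S′
    grow zero S _ n<∣S∣ = ⊥-elim (<⇒≱ n<∣S∣ (∣p∣≤n S))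
    grow (suc fuel) S reached bound with any? (λ y → step? S y ×-dec ¬? (y ∈? S))
    ... | no stuck =
      S , id , reached , λ {y} st → decidable-stable (y ∈? S) (λ y∉S → stuck (y , st , y∉S))
    ... | yes (y , st , y∉S) with grow fuel (S ∪ ⁅ y ⁆) (reached-step reached st) bound′
      where
        ∣S∣<∣S∪y∣ : ∣ S ∣ < ∣ S ∪ ⁅ y ⁆ ∣
        ∣S∣<∣S∪y∣ = p⊂q⇒∣p∣<∣q∣ (p⊆p∪q ⁅ y ⁆ , y , x∈p∪q⁺ (inj₂ (x∈⁅x⁆ y)) , y∉S)
        bound′ : n < fuel + ∣ S ∪ ⁅ y ⁆ ∣
        bound′ = ≤-trans bound
          (≤-trans (≤-reflexive (sym (+-suc fuel _))) (+-monoʳ-≤ fuel ∣S∣<∣S∪y∣))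
    ...   | S′ , S∪y⊆S′ , reached′ , closed′ =
      S′ , S∪y⊆S′ ∘ x∈p∪q⁺ ∘ inj₁ , reached′ , closed′

    component : ∀ s → A (inj₁ s) → Σ (Subset n) λ S → s ∈ S × Reached s S × Closed S
    component s As with grow (suc n) ⁅ s ⁆ reached-s (≤-trans (n<1+n n) (m≤m+n (suc n) _))
      where
        reached-s : Reached s ⁅ s ⁆
        reached-s x∈ rewrite x∈⁅y⁆⇒x≡y s x∈ = nil _ , λ { refl → As }
    ... | S , ⁅s⁆⊆S , reached , closed = S , ⁅s⁆⊆S (x∈⁅x⁆ s) , reached , closed

    closed-edge : ∀ {S} → Closed S → ∀ e → A (inj₂ e) →
                  (∀ {y} → y ∈ E e → A (inj₁ y) → y ∈ S) ⊎ (∀ {y} → y ∈ E e → y ∉ S)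
    closed-edge {S} closed e Ae with any? (λ x → (x ∈? S) ×-dec (x ∈? E e))
    ... | yes (x , x∈S , x∈e) = inj₁ λ y∈e Ay → closed (Ay , e , Ae , y∈e , x , x∈S , x∈e)
    ... | no apart            = inj₂ λ y∈e y∈S → apart (_ , y∈S , y∈e)

  connected⇒walk : Connected E → ∀ u v → Walk (inj₁ u) (inj₁ v)
  connected⇒walk conn u v with component u tt
    where open Closure (λ _ → ⊤) (λ _ → yes tt)
  ... | S , u∈S , reached , closed with v ∈? S
  ...   | yes v∈S = proj₁ (reached v∈S)
  ...   | no v∉S  = ⊥-elim (conn
    (S , ∁ S , (u , u∈S) , (v , x∉p⇒x∈∁p v∉S) , (λ _ → x∈p⇒x∉∁p) , ∈⊎∈∁ S , crossing))
    where
      crossing : ∀ e → ¬ (Meets (E e) S × Meets (E e) (∁ S))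
      crossing e ((x , x∈e , x∈S) , (y , y∈e , y∈∁S)) =
        x∈∁p⇒x∉p y∈∁S (closed (tt , e , tt , y∈e , x , x∈S , x∈e))

  module _ {w : Fin n} where
    open Closure (_≢ inj₁ w) (λ k → ¬? (k ≟ᴺ inj₁ w))

    avoidVertex : ¬ IsCutVertex E w → ∀ {u t} → u ≢ w → t ≢ w →
                  WalkAvoiding (inj₁ w) (inj₁ u) (inj₁ t)
    avoidVertex no-cut {u} {t} u≢w t≢w with component u (u≢w ∘ inj₁-injective)
    ... | S , u∈S , reached , closed with t ∈? S
    ...   | yes t∈S = reached t∈S
    ...   | no t∉S  = ⊥-elim (no-cut
      (S , V₂ , (u , u∈S) , (t , ∈V₂ t∉S t≢w) , S∩V₂=∅ , w∉S , w∉V₂ , cover , split))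
      where
        V₂ : Subset n
        V₂ = ∁ S ∩ ∁ ⁅ w ⁆

        ∈V₂ : ∀ {x} → x ∉ S → x ≢ w → x ∈ V₂
        ∈V₂ x∉S x≢w = x∈p∩q⁺ (x∉p⇒x∈∁p x∉S , x∉p⇒x∈∁p (x≢w ∘ x∈⁅y⁆⇒x≡y w))

        S∩V₂=∅ : DisjointSets S V₂
        S∩V₂=∅ x x∈S x∈V₂ = x∈∁p⇒x∉p (proj₁ (x∈p∩q⁻ _ _ x∈V₂)) x∈S

        w∉S : w ∉ S
        w∉S w∈S = proj₂ (reached w∈S) (end∈ʷ (proj₁ (reached w∈S))) refl

        w∉V₂ : w ∉ V₂
        w∉V₂ w∈V₂ = x∈∁p⇒x∉p (proj₂ (x∈p∩q⁻ _ _ w∈V₂)) (x∈⁅x⁆ w)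

        w-or : ∀ {P y} → (y ≢ w → y ∈ P) → y ∈ ⁅ w ⁆ ∪ P
        w-or {y = y} y∈P with y ≟ᶠ w
        ... | yes refl = x∈p∪q⁺ (inj₁ (x∈⁅x⁆ y))
        ... | no y≢w   = x∈p∪q⁺ (inj₂ (y∈P y≢w))

        cover : ∀ x → x ≡ w ⊎ x ∈ S ⊎ x ∈ V₂
        cover x with x ≟ᶠ w | x ∈? S
        ... | yes x≡w | _       = inj₁ x≡w
        ... | no _    | yes x∈S = inj₂ (inj₁ x∈S)
        ... | no x≢w  | no x∉S  = inj₂ (inj₂ (∈V₂ x∉S x≢w))

        split : ∀ e → E e ⊆ ⁅ w ⁆ ∪ S ⊎ E e ⊆ ⁅ w ⁆ ∪ V₂
        split e = Sum.map (λ inside y∈e → w-or λ y≢w → inside y∈e (y≢w ∘ inj₁-injective))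
                          (λ outside y∈e → w-or (∈V₂ (outside y∈e)))
                          (closed-edge closed e λ ())

  module _ {e : Fin m} where
    open Closure (_≢ inj₂ e) (λ k → ¬? (k ≟ᴺ inj₂ e))

    avoidEdge : ¬ IsCutEdge E e → ∀ u t → WalkAvoiding (inj₂ e) (inj₁ u) (inj₁ t)
    avoidEdge no-cut u t with component u (λ ())
    ... | S , u∈S , reached , closed with t ∈? S
    ...   | yes t∈S = reached t∈S
    ...   | no t∉S  = ⊥-elim (no-cut
      (S , ∁ S , (u , u∈S) , (t , x∉p⇒x∈∁p t∉S) , (λ _ → x∈p⇒x∉∁p) , ∈⊎∈∁ S , split))
      where
        split : ∀ f → f ≢ e → E f ⊆ S ⊎ E f ⊆ ∁ S
        split f f≢e = Sum.map (λ inside y∈f → inside y∈f λ ())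
                              (λ outside y∈f → x∉p⇒x∈∁p (outside y∈f))
                              (closed-edge closed f (f≢e ∘ inj₂-injective))

  avoidToVertex : TwoConnected E → ∀ u {w t} → inj₁ u ≢ w → inj₁ t ≢ w →
                  WalkAvoiding w (inj₁ u) (inj₁ t)
  avoidToVertex (_ , no-cut-vertex , _) u {inj₁ w} u≢w t≢w =
    avoidVertex {w} (no-cut-vertex w) (u≢w ∘ cong inj₁) (t≢w ∘ cong inj₁)
  avoidToVertex (_ , _ , no-cut-edge) u {inj₂ e} {t} _ _ = avoidEdge {e} (no-cut-edge e) u t

  -- u only serves as some vertex to compare with when w is a hyperedge
  vertexAvoiding : ∀ {e} → 2 ≤ ∣ E e ∣ → ∀ (u : Fin n) (w : Node) → ∃ λ x → x ∈ E e × inj₁ x ≢ w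
  vertexAvoiding {e} e≥2 u (inj₁ w) =
    Product.map₂ (Product.map₂ (_∘ inj₁-injective)) (∃∈-≢ (E e) w e≥2)
  vertexAvoiding {e} e≥2 u (inj₂ _) =
    Product.map₂ (Product.map₂ λ _ ()) (∃∈-≢ (E e) u e≥2)

  avoid : TwoConnected E → (∀ e → 2 ≤ ∣ E e ∣) → ∀ u {w y} → inj₁ u ≢ w → y ≢ w →
          WalkAvoiding w (inj₁ u) y
  avoid 2-conn _ u {y = inj₁ t} u≢w t≢w = avoidToVertex 2-conn u u≢w t≢w
  avoid 2-conn edge≥2 u {w} {inj₂ e} u≢w e≢w with vertexAvoiding (edge≥2 e) u w
  ... | x , x∈e , x≢w = avoidToVertex 2-conn u u≢w x≢w ++ᵂ x→e
    where
      x→e : WalkAvoiding w (inj₁ x) (inj₂ e)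
      x→e = cons _ x∈e (nil _) , λ { (inj₁ refl) → x≢w ; (inj₂ refl) → e≢w }

  pattern via e u∈e w∈e p = cons _ {inj₂ e} u∈e (cons _ {inj₁ _} w∈e p)

  bergeLength : ∀ {u v} → Walk (inj₁ u) (inj₁ v) → ℕ
  bergeLength (nil _)       = zero
  bergeLength (via _ _ _ p) = suc (bergeLength p)

  bergeVert : ∀ {u v} (p : Walk (inj₁ u) (inj₁ v)) → Fin (suc (bergeLength p)) → Fin n
  bergeVert {u} (nil _)       _        = u
  bergeVert {u} (via _ _ _ p) fzero    = u
  bergeVert     (via _ _ _ p) (fsuc i) = bergeVert p i

  bergeEdge : ∀ {u v} (p : Walk (inj₁ u) (inj₁ v)) → Fin (bergeLength p) → Fin m
  bergeEdge (via e _ _ p) fzero    = e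
  bergeEdge (via _ _ _ p) (fsuc i) = bergeEdge p i

  bergeVert-start : ∀ {u v} (p : Walk (inj₁ u) (inj₁ v)) → bergeVert p fzero ≡ u
  bergeVert-start (nil _)       = refl
  bergeVert-start (via _ _ _ _) = refl

  bergeVert-end : ∀ {u v} (p : Walk (inj₁ u) (inj₁ v)) → bergeVert p (fromℕ (bergeLength p)) ≡ v
  bergeVert-end (nil _)       = refl
  bergeVert-end (via _ _ _ p) = bergeVert-end p

  bergeVert∈ʷ : ∀ {u v} (p : Walk (inj₁ u) (inj₁ v)) i → inj₁ (bergeVert p i) ∈ʷ p
  bergeVert∈ʷ (nil _)       _        = refl
  bergeVert∈ʷ (via _ _ _ p) fzero    = inj₁ refl
  bergeVert∈ʷ (via _ _ _ p) (fsuc i) = inj₂ (inj₂ (bergeVert∈ʷ p i))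

  bergeEdge∈ʷ : ∀ {u v} (p : Walk (inj₁ u) (inj₁ v)) i → inj₂ (bergeEdge p i) ∈ʷ p
  bergeEdge∈ʷ (via _ _ _ p) fzero    = inj₂ (inj₁ refl)
  bergeEdge∈ʷ (via _ _ _ p) (fsuc i) = inj₂ (inj₂ (bergeEdge∈ʷ p i))

  bergeLink : ∀ {u v} (p : Walk (inj₁ u) (inj₁ v)) i →
              bergeVert p (inject₁ i) ∈ E (bergeEdge p i) × bergeVert p (fsuc i) ∈ E (bergeEdge p i)
  bergeLink (via e u∈e w∈e p) fzero    = u∈e , subst (_∈ E e) (sym (bergeVert-start p)) w∈e
  bergeLink (via _ _   _   p) (fsuc i) = bergeLink p i

  bergeVert-injective : ∀ {u v} (p : Walk (inj₁ u) (inj₁ v)) → IsPath p →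
                        Injective _≡_ _≡_ (bergeVert p)
  bergeVert-injective (nil _)       _                  {fzero}  {fzero}  _  = refl
  bergeVert-injective (via _ _ _ p) _                  {fzero}  {fzero}  _  = refl
  bergeVert-injective (via _ _ _ p) (u∉ , _)           {fzero}  {fsuc j} eq =
    ⊥-elim (u∉ (inj₂ (subst (λ x → inj₁ x ∈ʷ p) (sym eq) (bergeVert∈ʷ p j))))
  bergeVert-injective (via _ _ _ p) (u∉ , _)           {fsuc i} {fzero}  eq =
    ⊥-elim (u∉ (inj₂ (subst (λ x → inj₁ x ∈ʷ p) eq (bergeVert∈ʷ p i))))
  bergeVert-injective (via _ _ _ p) (_ , _ , p-path)   {fsuc i} {fsuc j} eq =
    cong fsuc (bergeVert-injective p p-path eq)

  bergeEdge-injective : ∀ {u v} (p : Walk (inj₁ u) (inj₁ v)) → IsPath p →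
                        Injective _≡_ _≡_ (bergeEdge p)
  bergeEdge-injective (via _ _ _ p) _                {fzero}  {fzero}  _  = refl
  bergeEdge-injective (via _ _ _ p) (_ , e∉ , _)     {fzero}  {fsuc j} eq =
    ⊥-elim (e∉ (subst (λ f → inj₂ f ∈ʷ p) (sym eq) (bergeEdge∈ʷ p j)))
  bergeEdge-injective (via _ _ _ p) (_ , e∉ , _)     {fsuc i} {fzero}  eq =
    ⊥-elim (e∉ (subst (λ f → inj₂ f ∈ʷ p) eq (bergeEdge∈ʷ p i)))
  bergeEdge-injective (via _ _ _ p) (_ , _ , p-path) {fsuc i} {fsuc j} eq =
    cong fsuc (bergeEdge-injective p p-path eq)

  toBergePath : ∀ {u v} (p : Walk (inj₁ u) (inj₁ v)) → IsPath p → BergePath E u v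
  toBergePath p p-path = record
    { len = bergeLength p ; vert = bergeVert p ; edge = bergeEdge p
    ; vert-inj = bergeVert-injective p p-path ; edge-inj = bergeEdge-injective p p-path
    ; start = bergeVert-start p ; end = bergeVert-end p ; link = bergeLink p }

  disjointWalks⇒disjointBergePaths : ∀ {u v} → DisjointWalks (inj₁ u) (inj₁ v) →
    Σ (BergePath E u v) λ P → Σ (BergePath E u v) λ Q → DisjointPaths P Q
  disjointWalks⇒disjointBergePaths {u} {v} T with toPath (left T) | toPath (right T)
  ... | p , p-path , p⊆ | q , q-path , q⊆ =
    toBergePath p p-path , toBergePath q q-path , shared-vert , shared-edge
    where
      shared : ∀ {k} → k ∈ʷ p → k ∈ʷ q → k ≡ inj₁ u ⊎ k ≡ inj₁ v
      shared k∈p k∈q = disjoint T (p⊆ k∈p) (q⊆ k∈q)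

      shared-vert : ∀ i j → bergeVert p i ≡ bergeVert q j → bergeVert p i ≡ u ⊎ bergeVert p i ≡ v
      shared-vert i j eq = Sum.map inj₁-injective inj₁-injective
        (shared (bergeVert∈ʷ p i) (subst (λ x → inj₁ x ∈ʷ q) (sym eq) (bergeVert∈ʷ q j)))

      shared-edge : ∀ i j → bergeEdge p i ≢ bergeEdge q j
      shared-edge i j eq
        with shared (bergeEdge∈ʷ p i) (subst (λ f → inj₂ f ∈ʷ q) (sym eq) (bergeEdge∈ʷ q j))
      ... | inj₁ ()
      ... | inj₂ ()

  disjointBergePaths : TwoConnected E → (∀ e → 2 ≤ ∣ E e ∣) → ∀ u v →
    Σ (BergePath E u v) λ P → Σ (BergePath E u v) λ Q → DisjointPaths P Q
  disjointBergePaths 2-conn edge≥2 u v = disjointWalks⇒disjointBergePaths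
    (Whitney.disjointWalks (inj₁ u) (avoid 2-conn edge≥2 u) (connected⇒walk (proj₁ 2-conn) u v))

lemma2p13 : ∀ {n m r : ℕ} → 3 ≤ r → r ≤ n → (E : Fin m → Subset n) →
    IsRGraph r E → TwoConnected E → (u v : Fin n) → u ≢ v →
    Σ (BergePath E u v) λ P → Σ (BergePath E u v) λ Q → DisjointPaths P Q
lemma2p13 3≤r _ E (_ , r-uniform) 2-conn u v _ = Incidence.disjointBergePaths E 2-conn edge≥2 u v
  where
    edge≥2 : ∀ e → 2 ≤ ∣ E e ∣
    edge≥2 e = subst (2 ≤_) (sym (r-uniform e)) (≤-trans (n≤1+n 2) 3≤r)
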